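{- Let $b\in\mathbb N$ and let $e$ be a resource expression with $e\Rightarrow_b\varepsilon'$, and let $e'$ be in the support of $\varepsilon'$. Then $|e|\le4^b|e'|$.
   Context: Resource terms $s::=x\mid\lambda x.s\mid\langle s\rangle\bar t$ and monomials $\bar t=[t_1,\dots,t_n]$ (finite multisets of resource terms), up to $\alpha$. Size: $|x|=1$, $|\lambda x.s|=1+|s|$, $|\langle s\rangle\bar t|=1+|s|+|\bar t|$, $|[s_1,\dots,s_n]|=\sum_i|s_i|$. $\mathbb N[\Delta]$: finite formal sums of resource expressions (support = expressions occurring); constructors extended to sums linearly in each argument. Multilinear substitution: for $x\notin\mathrm{fv}(\bar u)$, $x_1,\dots,x_m$ the free occurrences of $x$ in $e$ and $\bar u=[u_1,\dots,u_n]$, $e\langle\bar u/x\rangle=\sum_f e[u_1/x_{f(1)},\dots,u_n/x_{f(n)}]$ over bijections $f:\{1..n\}\to\{1..m\}$, extended bilinearly to sums. The relations $\Rightarrow_b\subseteq\Delta\times\mathbb N[\Delta]$ ($b\in\mathbb N$, parallel reduction with at most $b$ nested fired redexes) are defined inductively: $x\Rightarrow_b x$; $\lambda x.s\Rightarrow_b\lambda x.\sigma'$ if $s\Rightarrow_b\sigma'$; $\langle s\rangle\bar t\Rightarrow_b\langle\sigma'\rangle\bar\tau'$ if $s\Rightarrow_b\sigma'$ and $\bar t\Rightarrow_b\bar\tau'$; $[s_1,\dots,s_r]\Rightarrow_b[\sigma'_1,\dots,\sigma'_r]$ if $s_i\Rightarrow_b\sigma'_i$ for all $i$; $\langle\lambda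 x.s\rangle\bar t\Rightarrow_b\sigma'\langle\bar\tau'/x\rangle$ if $b\ge1$, $s\Rightarrow_{b-1}\sigma'$ and $\bar t\Rightarrow_{b-1}\bar\tau'$. -}

module Defs where

open import Data.Nat using (ℕ; zero; suc; _+_; _∸_; _≡ᵇ_; _<ᵇ_)
open import Data.Bool using (Bool; true; false; if_then_else_)
open import Data.List using (List; []; _∷_; map; concatMap; length)
open import Data.Product using (_×_; _,_; proj₁)

-- Resource terms, in de Bruijn notation (so terms are taken up to α).
-- A monomial (finite multiset of resource terms) is represented by a
-- List of terms; the order of the list is irrelevant for everything below.

data Term : Set where
  var : ℕ → Term
  lam : Term → Term
  app : Term → List Term → Term

Monomial : Set
Monomial = List Term

mutual
  size : Term → ℕ
  size (var _)   = 1
  size (lam s)   = 1 + size s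
  size (app s t) = 1 + size s + msize t

  msize : Monomial → ℕ
  msize []      = 0
  msize (s ∷ t) = size s + msize t

-- Finite formal sums ℕ[Δ] are represented by lists (the coefficient of
-- an expression is its number of occurrences); the support of a sum is
-- the set of its list elements.

TermSum : Set
TermSum = List Term

MonoSum : Set
MonoSum = List Monomial

mutual
  shift : ℕ → ℕ → Term → Term
  shift c k (var n)   = if n <ᵇ c then var n else var (n + k)
  shift c k (lam s)   = lam (shift (suc c) k s)
  shift c k (app s t) = app (shift c k s) (mshift c k t)

  mshift : ℕ → ℕ → Monomial → Monomial
  mshift c k []      = []
  mshift c k (s ∷ t) = shift c k s ∷ mshift c k t

-- Number of free occurrences of the variable bound at depth d
-- (the variable x of λx.s is index 0 in s, index d under d more binders).
mutual
  occ : ℕ → Term → ℕ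
  occ d (var n)   = if n ≡ᵇ d then 1 else 0
  occ d (lam s)   = occ (suc d) s
  occ d (app s t) = occ d s + mocc d t

  mocc : ℕ → Monomial → ℕ
  mocc d []      = 0
  mocc d (s ∷ t) = occ d s + mocc d t

-- fill d e us : replace the occurrences of the variable at depth d in e,
-- in left-to-right order, by the successive elements of us (each shifted
-- by d, since it is moved under d binders), and remove the binder
-- (variables above d are decremented).
-- It is only used when length us equals the number of occurrences.
mutual
  fill : ℕ → Term → List Term → Term × List Term
  fill d (var n) us with n ≡ᵇ d | n <ᵇ d
  ... | true  | _     with us
  ...   | []       = var n , []
  ...   | u ∷ us'  = shift 0 d u , us'
  fill d (var n) us | false | true  = var n , us
  fill d (var n) us | false | false = var (n ∸ 1) , us
  fill d (lam s) us with fill (suc d) s us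
  ... | s' , us' = lam s' , us'
  fill d (app s t) us with fill d s us
  ... | s' , us' with mfill d t us'
  ...   | t' , us'' = app s' t' , us''

  mfill : ℕ → Monomial → List Term → Monomial × List Term
  mfill d [] us = [] , us
  mfill d (s ∷ t) us with fill d s us
  ... | s' , us' with mfill d t us'
  ...   | t' , us'' = (s' ∷ t') , us''

-- All ways of inserting an element into a list, and all permutations
-- (by position: a list of length n has exactly n! permutations listed,
-- in bijection with the bijections {1..n} → {1..n}).
insertions : {A : Set} → A → List A → List (List A)
insertions x []       = (x ∷ []) ∷ []
insertions x (y ∷ ys) = (x ∷ y ∷ ys) ∷ map (y ∷_) (insertions x ys)

perms : {A : Set} → List A → List (List A)
perms []       = [] ∷ []
perms (x ∷ xs) = concatMap (insertions x) (perms xs)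

-- Multilinear substitution s⟨ū/x⟩ where s is the body of λx.s (x = index 0):
-- the sum over all bijections between the elements of ū and the free
-- occurrences of x (empty sum if their numbers differ).
msubst : Term → Monomial → TermSum
msubst s us with length us ≡ᵇ occ 0 s
... | true  = map (λ vs → proj₁ (fill 0 s vs)) (perms us)
... | false = []

msubstSum : TermSum → MonoSum → TermSum
msubstSum σ τ = concatMap (λ s → concatMap (λ t → msubst s t) τ) σ

lamSum : TermSum → TermSum
lamSum σ = map lam σ

appSum : TermSum → MonoSum → TermSum
appSum σ τ = concatMap (λ s → map (app s) τ) σ

-- [σ₁, σ₂, …] built one component at a time: consSum σ τ = [σ] · τ
consSum : TermSum → MonoSum → MonoSum
consSum σ τ = concatMap (λ s → map (s ∷_) τ) σ

-- Parallel reduction ⇒_b with at most b nested fired redexes.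
mutual
  data _⇒[_]_ : Term → ℕ → TermSum → Set where
    ⇒var : ∀ {b n} → var n ⇒[ b ] (var n ∷ [])
    ⇒lam : ∀ {b s σ} → s ⇒[ b ] σ → lam s ⇒[ b ] lamSum σ
    ⇒app : ∀ {b s t σ τ} → s ⇒[ b ] σ → t ⇒ₘ[ b ] τ → app s t ⇒[ b ] appSum σ τ
    ⇒β   : ∀ {b s t σ τ} → s ⇒[ b ] σ → t ⇒ₘ[ b ] τ →
           app (lam s) t ⇒[ suc b ] msubstSum σ τ

  data _⇒ₘ[_]_ : Monomial → ℕ → MonoSum → Set where
    ⇒nil  : ∀ {b} → [] ⇒ₘ[ b ] ([] ∷ [])
    ⇒cons : ∀ {b s t σ τ} → s ⇒[ b ] σ → t ⇒ₘ[ b ] τ →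
            (s ∷ t) ⇒ₘ[ b ] consSum σ τ

-- The constructor cases only need 4^b ≥ 1.
-- For a fired redex ⟨λx.s⟩t̄ with s ⇒ s′, t̄ ⇒ t̄′ and r a summand of
-- s′⟨t̄′/x⟩, the occ(x) = #t̄′ occurrences of x (each of size 1) are replaced by the
-- terms of t̄′, so |r| + occ(x) = |s′| + |t̄′|. Since occ(x) is at most both |s′| and
-- |t̄′|, each of them is at most |r|, whence
-- |⟨λx.s⟩t̄| = 2 + |s| + |t̄| ≤ 2 + 4^b (|s′| + |t̄′|) ≤ 4^(b+1) |r|.
module Submission where

open import Defs
open import Data.Nat using (ℕ; suc; _+_; _*_; _^_; _≤_; _>_; _≡ᵇ_; _<ᵇ_; z≤n; s≤s)
open import Data.Product using (_×_; _,_; proj₁; proj₂)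
open import Data.List.Membership.Propositional using (_∈_)

open import Data.Nat.Properties
open import Data.Nat.ListAction using (sum)
open import Data.Nat.ListAction.Properties using (sum-↭)
open import Data.Nat.Tactic.RingSolver using (solve-∀)
open import Data.Bool using (true; false)
open import Data.Unit using (tt)
open import Relation.Nullary using (contradiction)
open import Data.List using (List; []; _∷_; map; concatMap; length)
open import Data.List.Relation.Unary.All as All using (All; []; _∷_)
open import Data.List.Relation.Unary.All.Properties using (map⁺; concat⁺)
open import Data.List.Relation.Binary.Permutation.Propositional using (_↭_; ↭-refl; ↭-prep; ↭-swap; ↭-trans)
open import Data.List.Relation.Binary.Permutation.Propositional.Properties using (↭-length)
import Data.List.Relation.Binary.Permutation.Propositional.Properties as ↭
open import Relation.Binary.PropositionalEquality using (_≡_; refl; sym; trans; cong; cong₂; module ≡-Reasoning)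

private
  variable
    A B C : Set
    P Q R : A → Set
    xs ys : List A

All-concatMap⁺ : {f : A → List B} → All (λ x → All P (f x)) xs → All P (concatMap f xs)
All-concatMap⁺ ps = concat⁺ (map⁺ ps)

All-map₂⁺ : {f : A → B → C} → All P xs → All Q ys → (∀ {x y} → P x → Q y → R (f x y)) →
            All R (concatMap (λ x → map (f x) ys) xs)
All-map₂⁺ ps qs k = All-concatMap⁺ (All.map (λ p → map⁺ (All.map (k p) qs)) ps)

All-concatMap₂⁺ : {f : A → B → List C} → All P xs → All Q ys → (∀ {x y} → P x → Q y → All R (f x y)) →
                  All R (concatMap (λ x → concatMap (f x) ys) xs)
All-concatMap₂⁺ ps qs k = All-concatMap⁺ (All.map (λ p → All-concatMap⁺ (All.map (k p) qs)) ps)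

insertions-↭ : (x : A) (ys : List A) → All (_↭ x ∷ ys) (insertions x ys)
insertions-↭ x []       = ↭-refl ∷ []
insertions-↭ x (y ∷ ys) =
  ↭-refl ∷ map⁺ (All.map (λ p → ↭-trans (↭-prep y p) (↭-swap y x ↭-refl)) (insertions-↭ x ys))

perms-↭ : (xs : List A) → All (_↭ xs) (perms xs)
perms-↭ []       = ↭-refl ∷ []
perms-↭ (x ∷ xs) =
  All-concatMap⁺ (All.map (λ {ws} p → All.map (λ q → ↭-trans q (↭-prep x p)) (insertions-↭ x ws)) (perms-↭ xs))

mutual
  size-shift : ∀ c k s → size (shift c k s) ≡ size s
  size-shift c k (var n) with n <ᵇ c
  ... | true  = refl
  ... | false = refl
  size-shift c k (lam s)   = cong suc (size-shift (suc c) k s)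
  size-shift c k (app s t) = cong suc (cong₂ _+_ (size-shift c k s) (msize-mshift c k t))

  msize-mshift : ∀ c k t → msize (mshift c k t) ≡ msize t
  msize-mshift c k []      = refl
  msize-mshift c k (s ∷ t) = cong₂ _+_ (size-shift c k s) (msize-mshift c k t)

size>0 : ∀ s → size s > 0
size>0 (var _)   = s≤s z≤n
size>0 (lam _)   = s≤s z≤n
size>0 (app _ _) = s≤s z≤n

length≤msize : ∀ t → length t ≤ msize t
length≤msize []      = z≤n
length≤msize (s ∷ t) = +-mono-≤ (size>0 s) (length≤msize t)

length≡0⇒msize≡0 : ∀ t → length t ≡ 0 → msize t ≡ 0
length≡0⇒msize≡0 [] refl = refl

msize≡sum : ∀ t → msize t ≡ sum (map size t)
msize≡sum []      = refl
msize≡sum (s ∷ t) = cong (size s +_) (msize≡sum t)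

msize-↭ : ∀ {t u} → t ↭ u → msize t ≡ msize u
msize-↭ {t} {u} p = trans (msize≡sum t) (trans (sum-↭ (↭.map⁺ size p)) (sym (msize≡sum u)))

mutual
  occ≤size : ∀ d s → occ d s ≤ size s
  occ≤size d (var n) with n ≡ᵇ d
  ... | true  = s≤s z≤n
  ... | false = z≤n
  occ≤size d (lam s)   = m≤n⇒m≤1+n (occ≤size (suc d) s)
  occ≤size d (app s t) = m≤n⇒m≤1+n (+-mono-≤ (occ≤size d s) (mocc≤msize d t))

  mocc≤msize : ∀ d t → mocc d t ≤ msize t
  mocc≤msize d []      = z≤n
  mocc≤msize d (s ∷ t) = +-mono-≤ (occ≤size d s) (mocc≤msize d t)

-- A piece of size n with o holes, filled from the supply us, becomes a piece of
-- size n′ leaving rest: the o variables are replaced by the consumed prefix of us.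
record Filling (o n : ℕ) (us : List Term) (n′ : ℕ) (rest : List Term) : Set where
  constructor filling
  field
    length-consumed : o + length rest ≡ length us
    size-conserved  : n′ + o + msize rest ≡ n + msize us

Filling-suc : ∀ {o n us n′ rest} → Filling o n us n′ rest → Filling o (suc n) us (suc n′) rest
Filling-suc (filling l z) = filling l (cong suc z)

Filling-+ : ∀ {o₁ o₂ n₁ n₂ n₁′ n₂′ us us′ us″} →
            Filling o₁ n₁ us n₁′ us′ → Filling o₂ n₂ us′ n₂′ us″ →
            Filling (o₁ + o₂) (n₁ + n₂) us (n₁′ + n₂′) us″
Filling-+ {o₁} {o₂} {n₁} {n₂} {n₁′} {n₂′} {us} {us′} {us″} (filling l₁ z₁) (filling l₂ z₂) =
  filling length-consumed size-conserved
  where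
    open ≡-Reasoning
    length-consumed : o₁ + o₂ + length us″ ≡ length us
    length-consumed = begin
      o₁ + o₂ + length us″   ≡⟨ +-assoc o₁ o₂ _ ⟩
      o₁ + (o₂ + length us″) ≡⟨ cong (o₁ +_) l₂ ⟩
      o₁ + length us′        ≡⟨ l₁ ⟩
      length us              ∎
    size-conserved : n₁′ + n₂′ + (o₁ + o₂) + msize us″ ≡ n₁ + n₂ + msize us
    size-conserved = begin
      n₁′ + n₂′ + (o₁ + o₂) + msize us″  ≡⟨ interleave n₁′ n₂′ o₁ o₂ (msize us″) ⟩
      n₁′ + o₁ + (n₂′ + o₂ + msize us″)  ≡⟨ cong (n₁′ + o₁ +_) z₂ ⟩
      n₁′ + o₁ + (n₂ + msize us′)        ≡⟨ bring-forward (n₁′ + o₁) n₂ (msize us′) ⟩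
      n₂ + (n₁′ + o₁ + msize us′)        ≡⟨ cong (n₂ +_) z₁ ⟩
      n₂ + (n₁ + msize us)               ≡⟨ +-comm-assoc n₂ n₁ (msize us) ⟩
      n₁ + n₂ + msize us                 ∎
      where
        interleave : ∀ a b c d e → a + b + (c + d) + e ≡ a + c + (b + d + e)
        interleave = solve-∀
        bring-forward : ∀ a b c → a + (b + c) ≡ b + (a + c)
        bring-forward = solve-∀
        +-comm-assoc : ∀ a b c → a + (b + c) ≡ b + a + c
        +-comm-assoc = solve-∀

supply-suffices : ∀ {o₁ o₂ n m} → o₁ + o₂ ≤ n → o₁ + m ≡ n → o₂ ≤ m
supply-suffices {o₁} h l = +-cancelˡ-≤ o₁ _ _ (≤-trans h (≤-reflexive (sym l)))

mutual
  fill-Filling : ∀ d s us → occ d s ≤ length us →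
                 Filling (occ d s) (size s) us (size (proj₁ (fill d s us))) (proj₂ (fill d s us))
  fill-Filling d (var n) us h with n ≡ᵇ d | n <ᵇ d
  ... | true | _ with us
  ...   | []      = contradiction h λ ()
  ...   | u ∷ us′ = filling refl (trans (cong (λ m → m + 1 + msize us′) (size-shift 0 d u))
                                        (one-forward (size u) (msize us′)))
    where
      one-forward : ∀ a b → a + 1 + b ≡ 1 + (a + b)
      one-forward = solve-∀
  fill-Filling d (var n) us h | false | true  = filling refl refl
  fill-Filling d (var n) us h | false | false = filling refl refl
  fill-Filling d (lam s) us h with fill (suc d) s us | fill-Filling (suc d) s us h
  ... | _ | F = Filling-suc F
  fill-Filling d (app s t) us h with fill d s us | fill-Filling d s us (≤-trans (m≤m+n _ _) h)
  ... | _ , us′ | F with mfill d t us′ | mfill-Filling d t us′ (supply-suffices h (Filling.length-consumed F))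
  ...   | _ | G = Filling-suc (Filling-+ F G)

  mfill-Filling : ∀ d t us → mocc d t ≤ length us →
                  Filling (mocc d t) (msize t) us (msize (proj₁ (mfill d t us))) (proj₂ (mfill d t us))
  mfill-Filling d [] us h = filling refl refl
  mfill-Filling d (s ∷ t) us h with fill d s us | fill-Filling d s us (≤-trans (m≤m+n _ _) h)
  ... | _ , us′ | F with mfill d t us′ | mfill-Filling d t us′ (supply-suffices h (Filling.length-consumed F))
  ...   | _ | G = Filling-+ F G

msubst-conserves-size : ∀ s us →
  All (λ r → occ 0 s ≡ length us × size r + occ 0 s ≡ size s + msize us) (msubst s us)
msubst-conserves-size s us with length us ≡ᵇ occ 0 s | ≡ᵇ⇒≡ (length us) (occ 0 s)
... | false | _         = []
... | true  | length≡occ = map⁺ (All.map conserves (perms-↭ us))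
  where
    occ≡length : occ 0 s ≡ length us
    occ≡length = sym (length≡occ tt)

    conserves : ∀ {vs} → vs ↭ us → occ 0 s ≡ length us × size (proj₁ (fill 0 s vs)) + occ 0 s ≡ size s + msize us
    conserves {vs} p with filling l z ← fill-Filling 0 s vs (≤-reflexive (trans occ≡length (sym (↭-length p)))) =
      occ≡length ,
      (begin
        size r + occ 0 s              ≡⟨ +-identityʳ _ ⟨
        size r + occ 0 s + 0          ≡⟨ cong (size r + occ 0 s +_) (length≡0⇒msize≡0 rest nothing-left) ⟨
        size r + occ 0 s + msize rest ≡⟨ z ⟩
        size s + msize vs             ≡⟨ cong (size s +_) (msize-↭ p) ⟩
        size s + msize us             ∎)
      where
        open ≡-Reasoning
        r = proj₁ (fill 0 s vs)
        rest = proj₂ (fill 0 s vs)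
        nothing-left : length rest ≡ 0
        nothing-left = +-cancelˡ-≡ (occ 0 s) _ _
          (trans l (trans (↭-length p) (trans (sym occ≡length) (sym (+-identityʳ _)))))

msubst-dominates : ∀ s us → All (λ r → size s ≤ size r × msize us ≤ size r) (msubst s us)
msubst-dominates s us = All.map (λ {r} → dominates {r}) (msubst-conserves-size s us)
  where
    dominates : ∀ {r} → occ 0 s ≡ length us × size r + occ 0 s ≡ size s + msize us →
                size s ≤ size r × msize us ≤ size r
    dominates (occ≡length , conserved) =
      +-cancelʳ-≤ (occ 0 s) _ _ (≤-trans (+-monoʳ-≤ (size s) occ≤msize) (≤-reflexive (sym conserved))) ,
      +-cancelʳ-≤ (occ 0 s) _ _ (≤-trans (≤-reflexive (+-comm (msize us) _))
                                  (≤-trans (+-monoˡ-≤ (msize us) (occ≤size 0 s)) (≤-reflexive (sym conserved))))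
      where
        occ≤msize : occ 0 s ≤ msize us
        occ≤msize = ≤-trans (≤-reflexive occ≡length) (length≤msize us)

scaled-+ : ∀ k {m m′ n n′} → m ≤ k * n → m′ ≤ k * n′ → m + m′ ≤ k * (n + n′)
scaled-+ k {n = n} {n′} h h′ = ≤-trans (+-mono-≤ h h′) (≤-reflexive (sym (*-distribˡ-+ k n n′)))

scaled-suc : ∀ {k m n} → k > 0 → m ≤ k * n → suc m ≤ k * suc n
scaled-suc {k} {n = n} k>0 h = ≤-trans (+-mono-≤ k>0 h) (≤-reflexive (sym (*-suc k n)))

redex-bound : ∀ {k m m′ n n′ r} → k > 0 → r > 0 → m ≤ k * n → m′ ≤ k * n′ → n ≤ r → n′ ≤ r →
              2 + (m + m′) ≤ 4 * k * r
redex-bound {k} {m} {m′} {r = r} k>0 r>0 h h′ n≤r n′≤r = begin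
  2 + (m + m′)                      ≤⟨ +-mono-≤ (+-mono-≤ kr>0 kr>0) (+-mono-≤ (bound h n≤r) (bound h′ n′≤r)) ⟩
  k * r + k * r + (k * r + k * r)   ≡⟨ four-times (k * r) ⟩
  4 * (k * r)                       ≡⟨ *-assoc 4 k r ⟨
  4 * k * r                         ∎
  where
    open ≤-Reasoning
    kr>0 : k * r > 0
    kr>0 = *-mono-≤ k>0 r>0
    bound : ∀ {x y} → x ≤ k * y → y ≤ r → x ≤ k * r
    bound x≤ky y≤r = ≤-trans x≤ky (*-monoʳ-≤ k y≤r)
    four-times : ∀ a → a + a + (a + a) ≡ 4 * a
    four-times = solve-∀

4^b>0 : ∀ b → 4 ^ b > 0
4^b>0 = m^n>0 4

mutual
  ⇒-size-bound : ∀ {b e ε′} → e ⇒[ b ] ε′ → All (λ e′ → size e ≤ 4 ^ b * size e′) ε′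
  ⇒-size-bound {b} ⇒var = ≤-trans (4^b>0 b) (≤-reflexive (sym (*-identityʳ _))) ∷ []
  ⇒-size-bound {b} (⇒lam d) = map⁺ (All.map (scaled-suc (4^b>0 b)) (⇒-size-bound d))
  ⇒-size-bound {b} (⇒app d d′) =
    All-map₂⁺ (⇒-size-bound d) (⇒ₘ-size-bound d′) (λ h h′ → scaled-suc (4^b>0 b) (scaled-+ (4 ^ b) h h′))
  ⇒-size-bound {suc b} (⇒β d d′) =
    All-concatMap₂⁺ (⇒-size-bound d) (⇒ₘ-size-bound d′) λ {s′} {t′} h h′ →
      All.map (λ {r} (s′≤r , t′≤r) → redex-bound (4^b>0 b) (size>0 r) h h′ s′≤r t′≤r)
              (msubst-dominates s′ t′)

  ⇒ₘ-size-bound : ∀ {b e ε′} → e ⇒ₘ[ b ] ε′ → All (λ e′ → msize e ≤ 4 ^ b * msize e′) ε′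
  ⇒ₘ-size-bound ⇒nil = z≤n ∷ []
  ⇒ₘ-size-bound {b} (⇒cons d d′) = All-map₂⁺ (⇒-size-bound d) (⇒ₘ-size-bound d′) (scaled-+ (4 ^ b))

lemma6p12 : (b : ℕ) →
    ((e : Term) (ε' : TermSum) → e ⇒[ b ] ε' → (e' : Term) → e' ∈ ε' → size e ≤ 4 ^ b * size e')
    × ((e : Monomial) (ε' : MonoSum) → e ⇒ₘ[ b ] ε' → (e' : Monomial) → e' ∈ ε' → msize e ≤ 4 ^ b * msize e')
lemma6p12 b = (λ _ _ d _ e′∈ε′ → All.lookup (⇒-size-bound d) e′∈ε′)
            , (λ _ _ d _ e′∈ε′ → All.lookup (⇒ₘ-size-bound d) e′∈ε′)
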